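{- Let $r,s\in\mathbb N$ with $r\ge 2s+1$, and let $a_1,\dots,a_{2s}\in[1,r-1]$ with $a_i<a_{i+1}$ for $i=1,\dots,2s-1$. Let $x_1=a_1$, $x_i=\sum_{j=0}^{i-1}a_{2j+1}-\sum_{j=1}^{i-1}a_{2j}$ for $i=2,\dots,s$, and $y_i=\sum_{j=0}^{i-1}a_{2j+1}-\sum_{j=1}^{i}a_{2j}+r$ for $i=1,\dots,s$. Let $G$ be a bipartite graph with vertex bipartition $\{A,B\}$ with $|A|=s$, $|B|=s+1$, and let $f\colon A\cup B\to[0,r-1]$ be a $\overline{\rho}$-labeling with $f(A)=\{x_1-1,\dots,x_s-1\}$ and $f(B)=\{y_1-1,\dots,y_s-1,r-1\}$. Then: (1) the $k$-shift $f_k$ is an $(A,B,r-1)$-uniformly ordered labeling of $G$ if and only if $k\in\{0\}\cup[r+1-a_1,r-1]$ when $a_1\ge 2$, and if and only if $k=0$ when $a_1=1$; (2) $f_k$ is $(B,A,r-1)$-uniformly ordered if and only if $k\in[r+1-y_s,\,r-x_s]$.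
   Context: $\mathbb N=\{0,1,2,\dots\}$; $[a,b]=\{x\in\mathbb N: a\le x\le b\}$. Graphs have no isolated vertices. For a graph $G=(V,E)$ with $|E|=m$ and $t\in\mathbb N$, a labeling is an injective map $f\colon V\to[0,t]$; it induces $\tilde f(\{u,v\})=|f(u)-f(v)|$. $f$ is a $\overline{\rho}$-labeling if (a) $t\ge 2m$, (b) $\tilde f$ is injective, (c) there is no $i\in\{1,\dots,m\}$ with both $i$ and $t+1-i$ in $\operatorname{Im}\tilde f$. For bipartite $G$ with vertex bipartition $\{A,B\}$, an $(A,B,t)$-uniformly ordered labeling is a $\overline{\rho}$-labeling $f\colon V\to[0,t]$ such that there is $\lambda\in\mathbb N$ with $f(a)\le\lambda$ for all $a\in A$ and $f(b)>\lambda$ for all $b\in B$; $(B,A,t)$-uniformly ordered is defined with $A,B$ exchanged. For $k\in[0,t]$, the $k$-shift of $f$ is $f_k(v)=f(v)+k$ reduced modulo $t+1$ into $[0,t]$. -}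

module Defs where

open import Data.Nat using (ℕ; zero; suc; _+_; _*_; _∸_; _≤_; _<_; ∣_-_∣)
open import Data.Nat.DivMod using (_%_)
open import Data.Fin using (Fin)
open import Data.Product using (Σ; ∃; _×_; _,_)
open import Data.Sum using (_⊎_; inj₁; inj₂)
open import Data.List using (List; length)
open import Data.List.Membership.Propositional using (_∈_)
open import Data.List.Relation.Unary.Unique.Propositional using (Unique)
open import Relation.Nullary using (¬_)
open import Relation.Binary.PropositionalEquality using (_≡_)
open import Function.Definitions using (Injective)

sumTo : (ℕ → ℕ) → ℕ → ℕ
sumTo g zero    = 0
sumTo g (suc n) = sumTo g n + g n

-- The sequence a is 1-indexed: a i for i = 1 .. 2s (values elsewhere unused).
-- x i = Σ_{j=0}^{i-1} a_{2j+1} - Σ_{j=1}^{i-1} a_{2j}   (also gives x 1 = a 1)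
xs : (ℕ → ℕ) → ℕ → ℕ
xs a i = sumTo (λ j → a (suc (2 * j))) i ∸ sumTo (λ j → a (2 * suc j)) (i ∸ 1)

ys : (ℕ → ℕ) → ℕ → ℕ → ℕ
ys a r i = (sumTo (λ j → a (suc (2 * j))) i + r) ∸ sumTo (λ j → a (2 * suc j)) i

-- A bipartite graph with parts A (of size p) and B (of size q):
-- vertices Fin p ⊎ Fin q (A = inj₁-part, B = inj₂-part), edges {a,b} given by
-- a duplicate-free list of pairs (a , b), and no isolated vertices.
record BipGraph (p q : ℕ) : Set where
  field
    edges      : List (Fin p × Fin q)
    simple     : Unique edges
    noIsolA    : ∀ (x : Fin p) → ∃ λ (y : Fin q) → (x , y) ∈ edges
    noIsolB    : ∀ (y : Fin q) → ∃ λ (x : Fin p) → (x , y) ∈ edges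
open BipGraph public

Vtx : ℕ → ℕ → Set
Vtx p q = Fin p ⊎ Fin q

edgeLabel : ∀ {p q} → (Vtx p q → ℕ) → Fin p × Fin q → ℕ
edgeLabel f (x , y) = ∣ f (inj₁ x) - f (inj₂ y) ∣

InImage : ∀ {p q} → BipGraph p q → (Vtx p q → ℕ) → ℕ → Set
InImage G f d = ∃ λ e → e ∈ edges G × edgeLabel f e ≡ d

record IsRhoBar {p q} (G : BipGraph p q) (t : ℕ) (f : Vtx p q → ℕ) : Set where
  field
    inj      : Injective _≡_ _≡_ f
    bounded  : ∀ v → f v ≤ t
    tBig     : 2 * length (edges G) ≤ t
    labInj   : ∀ e₁ e₂ → e₁ ∈ edges G → e₂ ∈ edges G →
               edgeLabel f e₁ ≡ edgeLabel f e₂ → e₁ ≡ e₂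
    noPair   : ¬ (∃ λ i → 1 ≤ i × i ≤ length (edges G) ×
                  InImage G f i × InImage G f (suc t ∸ i))

UniformAB : ∀ {p q} → BipGraph p q → ℕ → (Vtx p q → ℕ) → Set
UniformAB G t f = IsRhoBar G t f ×
  ∃ λ (l : ℕ) → (∀ x → f (inj₁ x) ≤ l) × (∀ y → l < f (inj₂ y))

UniformBA : ∀ {p q} → BipGraph p q → ℕ → (Vtx p q → ℕ) → Set
UniformBA G t f = IsRhoBar G t f ×
  ∃ λ (l : ℕ) → (∀ y → f (inj₂ y) ≤ l) × (∀ x → l < f (inj₁ x))

shift : ∀ {p q} → ℕ → (Vtx p q → ℕ) → ℕ → Vtx p q → ℕ
shift t f k v = (f v + k) % suc t

{-# OPTIONS --safe #-}
-- Write t = r − 1. The labels of A lie in [α, β] and those of B in [γ, t], where α = a₁ − 1,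
-- β = x_s − 1 and γ = y_s − 1 are attained: the telescoping sums make the x_i increase and the
-- y_i decrease, with x_s < y_s. Under the k-shift a label ℓ either stays at ℓ + k or wraps
-- around to ℓ + k − (t + 1). If all labels move alike (k = 0, or t < α + k) the shift is a
-- translation, which keeps the edge labels and the order of the vertices, so f_k is
-- (A,B)-ordered. If A stays and B wraps (t < γ + k and β + k ≤ t), every edge label d becomes
-- t + 1 − d, which keeps the ρ̄-conditions, and B now lies below A. In every other case one of
-- the vertices labelled α, β, γ or t lands on the wrong side.
module Submission where

open import Defs
open import Data.Fin as Fin using (Fin)
open import Data.Fin.Properties using (¬Fin0)
open import Data.List using (length)
open import Data.List.Membership.Propositional using (_∈_)
open import Data.Nat
open import Data.Nat.DivMod
open import Data.Nat.Properties
open import Algebra.Properties.CommutativeSemigroup +-commutativeSemigroup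
  using (xy∙z≈xz∙y; xy∙z≈x∙zy; x∙yz≈xz∙y)
open import Data.Product using (∃; _×_; _,_; proj₁; proj₂; map)
open import Data.Product.Function.NonDependent.Propositional using (_×-⇔_)
open import Data.Sum using (_⊎_; inj₁; inj₂; [_,_])
open import Data.Sum.Function.Propositional using (_⊎-⇔_)
open import Data.Empty using (⊥-elim)
open import Function.Base using (_∘_; id)
open import Function.Bundles using (_⇔_; mk⇔; Equivalence)
open import Function.Construct.Composition using (_⇔-∘_)
open import Function.Construct.Identity using (⇔-id)
open import Function.Definitions using (Injective)
open import Relation.Binary.Definitions using (Reflexive; Transitive)
open import Relation.Binary.PropositionalEquality hiding ([_])
open import Relation.Nullary using (yes; no; contradiction)

[m%n+o]%n≡[m+o]%n : ∀ m o n .{{_ : NonZero n}} → (m % n + o) % n ≡ (m + o) % n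
[m%n+o]%n≡[m+o]%n m o n = begin
  (m % n + o) % n          ≡⟨ %-distribˡ-+ (m % n) o n ⟩
  (m % n % n + o % n) % n  ≡⟨ cong (λ z → (z + o % n) % n) (m%n%n≡m%n m n) ⟩
  (m % n + o % n) % n      ≡⟨ %-distribˡ-+ m o n ⟨
  (m + o) % n              ∎
  where open ≡-Reasoning

[[m+k]%n+[n∸k]]%n≡m : ∀ {m k n} .{{_ : NonZero n}} → m < n → k ≤ n →
                      ((m + k) % n + (n ∸ k)) % n ≡ m
[[m+k]%n+[n∸k]]%n≡m {m} {k} {n} m<n k≤n = begin
  ((m + k) % n + (n ∸ k)) % n  ≡⟨ [m%n+o]%n≡[m+o]%n (m + k) (n ∸ k) n ⟩
  (m + k + (n ∸ k)) % n        ≡⟨ cong (_% n) (+-assoc m k (n ∸ k)) ⟩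
  (m + (k + (n ∸ k))) % n      ≡⟨ cong (λ z → (m + z) % n) (m+[n∸m]≡n k≤n) ⟩
  (m + n) % n                  ≡⟨ [m+n]%n≡m%n m n ⟩
  m % n                        ≡⟨ m<n⇒m%n≡m m<n ⟩
  m                            ∎
  where open ≡-Reasoning

+-%-injective : ∀ {m m′ k n} .{{_ : NonZero n}} → m < n → m′ < n → k ≤ n →
                (m + k) % n ≡ (m′ + k) % n → m ≡ m′
+-%-injective {m} {m′} {k} {n} m<n m′<n k≤n eq = begin
  m                             ≡⟨ [[m+k]%n+[n∸k]]%n≡m m<n k≤n ⟨
  ((m + k) % n + (n ∸ k)) % n   ≡⟨ cong (λ z → (z + (n ∸ k)) % n) eq ⟩
  ((m′ + k) % n + (n ∸ k)) % n  ≡⟨ [[m+k]%n+[n∸k]]%n≡m m′<n k≤n ⟩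
  m′                            ∎
  where open ≡-Reasoning

[m+k]%[1+t]+[1+t]≡m+k : ∀ {m k t} → m ≤ t → k ≤ t → t < m + k →
                        (m + k) % suc t + suc t ≡ m + k
[m+k]%[1+t]+[1+t]≡m+k {m} {k} {t} m≤t k≤t t<m+k = begin
  (m + k) % suc t + suc t          ≡⟨ cong (_+ suc t) (m≤n⇒[n∸m]%m≡n%m t<m+k) ⟨
  (m + k ∸ suc t) % suc t + suc t  ≡⟨ cong (_+ suc t) (m≤n⇒m%n≡m m+k∸[1+t]≤t) ⟩
  m + k ∸ suc t + suc t            ≡⟨ m∸n+n≡m t<m+k ⟩
  m + k                            ∎
  where
  open ≡-Reasoning
  m+k∸[1+t]≤t : m + k ∸ suc t ≤ t
  m+k∸[1+t]≤t = m≤n+o⇒m∸n≤o (m + k) (suc t) (m≤n⇒m≤1+n (+-mono-≤ m≤t k≤t))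

module _ {u v x y c d : ℕ} (u≈x : u + c ≡ x + d) (v≈y : v + c ≡ y + d) where

  translate-≤ : x ≤ y → u ≤ v
  translate-≤ x≤y = +-cancelʳ-≤ c u v (subst₂ _≤_ (sym u≈x) (sym v≈y) (+-monoˡ-≤ d x≤y))

  translate-< : x < y → u < v
  translate-< x<y = +-cancelʳ-< c u v (subst₂ _<_ (sym u≈x) (sym v≈y) (+-monoˡ-< d x<y))

  translate-dist : ∣ u - v ∣ ≡ ∣ x - y ∣
  translate-dist = begin
    ∣ u - v ∣          ≡⟨ ∣m+n-m+o∣≡∣n-o∣ c u v ⟨
    ∣ c + u - c + v ∣  ≡⟨ cong₂ ∣_-_∣ (+-comm c u) (+-comm c v) ⟩
    ∣ u + c - v + c ∣  ≡⟨ cong₂ ∣_-_∣ u≈x v≈y ⟩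
    ∣ x + d - y + d ∣  ≡⟨ cong₂ ∣_-_∣ (+-comm x d) (+-comm y d) ⟩
    ∣ d + x - d + y ∣  ≡⟨ ∣m+n-m+o∣≡∣n-o∣ d x y ⟩
    ∣ x - y ∣          ∎
    where open ≡-Reasoning

translate-edgeLabel : ∀ {p q} {f g : Vtx p q → ℕ} {c d} → (∀ v → g v + c ≡ f v + d) →
                      ∀ e → edgeLabel g e ≡ edgeLabel f e
translate-edgeLabel {f = f} {g} translation (x , y) =
  translate-dist {g (inj₁ x)} {g (inj₂ y)} {f (inj₁ x)} {f (inj₂ y)}
    (translation (inj₁ x)) (translation (inj₂ y))

complement-dist : ∀ {u v x y k n} → u + 0 ≡ x + k → v + n ≡ y + k → x ≤ y → y ≤ x + n →
                  ∣ u - v ∣ ≡ n ∸ ∣ x - y ∣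
complement-dist {u} {v} {x} {y} {k} {n} u≈x v≈y x≤y y≤x+n = begin
  ∣ u - v ∣              ≡⟨ translate-dist {u} {v} {x + n} {y} u+n≈x+n v≈y ⟩
  ∣ x + n - y ∣          ≡⟨ m≤n⇒∣n-m∣≡n∸m y≤x+n ⟩
  x + n ∸ y              ≡⟨ cong (x + n ∸_) (m+[n∸m]≡n x≤y) ⟨
  x + n ∸ (x + (y ∸ x))  ≡⟨ [m+n]∸[m+o]≡n∸o x n (y ∸ x) ⟩
  n ∸ (y ∸ x)            ≡⟨ cong (n ∸_) (m≤n⇒∣m-n∣≡n∸m x≤y) ⟨
  n ∸ ∣ x - y ∣          ∎
  where
  open ≡-Reasoning
  u+n≈x+n : u + n ≡ x + n + k
  u+n≈x+n = begin
    u + n      ≡⟨ cong (_+ n) (+-identityʳ u) ⟨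
    u + 0 + n  ≡⟨ cong (_+ n) u≈x ⟩
    x + k + n  ≡⟨ xy∙z≈xz∙y x k n ⟩
    x + n + k  ∎

+-balance-< : ∀ {x y b c} → x + b ≡ y + c → b < c → y < x
+-balance-< {x} {y} {b} x+b≡y+c b<c =
  +-cancelʳ-< b y x (<-≤-trans (+-monoʳ-< y b<c) (≤-reflexive (sym x+b≡y+c)))

module _ (R : ℕ → ℕ → Set) (R-refl : Reflexive R) (R-trans : Transitive R) {s : ℕ}
         (R-step : ∀ i → 1 ≤ i → suc i ≤ s → R i (suc i)) where

  stepwise : ∀ {i j} → 1 ≤ i → i ≤ j → j ≤ s → R i j
  stepwise {i} 1≤i i≤j = go (≤⇒≤′ i≤j)
    where
    go : ∀ {j} → i ≤′ j → j ≤ s → R i j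
    go ≤′-refl        _   = R-refl
    go (≤′-step i≤′j) j<s =
      R-trans (go i≤′j (<⇒≤ j<s)) (R-step _ (≤-trans 1≤i (≤′⇒≤ i≤′j)) j<s)

module _ {p q} {G : BipGraph p q} {t : ℕ} {f g : Vtx p q → ℕ} (ρ : IsRhoBar G t f)
         (g-injective : Injective _≡_ _≡_ g) (g≤t : ∀ v → g v ≤ t) where
  open IsRhoBar ρ

  isRhoBar-sameLabels : (∀ e → e ∈ edges G → edgeLabel g e ≡ edgeLabel f e) → IsRhoBar G t g
  isRhoBar-sameLabels same = record
    { inj     = g-injective
    ; bounded = g≤t
    ; tBig    = tBig
    ; labInj  = λ e₁ e₂ e₁∈ e₂∈ eq →
        labInj e₁ e₂ e₁∈ e₂∈ (trans (sym (same e₁ e₁∈)) (trans eq (same e₂ e₂∈)))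
    ; noPair  = λ (i , 1≤i , i≤m , image₁ , image₂) →
        noPair (i , 1≤i , i≤m , sameImage image₁ , sameImage image₂)
    }
    where
    sameImage : ∀ {d} → InImage G g d → InImage G f d
    sameImage (e , e∈ , ge≡d) = e , e∈ , trans (sym (same e e∈)) ge≡d

  edgeLabel≤t : ∀ e → edgeLabel f e ≤ t
  edgeLabel≤t (x , y) = ≤-trans (∣m-n∣≤m⊔n (f (inj₁ x)) (f (inj₂ y)))
                                (⊔-lub (bounded (inj₁ x)) (bounded (inj₂ y)))

  isRhoBar-complementLabels : (∀ e → e ∈ edges G → edgeLabel g e ≡ suc t ∸ edgeLabel f e) →
                              IsRhoBar G t g
  isRhoBar-complementLabels compl = record
    { inj     = g-injective
    ; bounded = g≤t
    ; tBig    = tBig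
    ; labInj  = λ e₁ e₂ e₁∈ e₂∈ eq →
        labInj e₁ e₂ e₁∈ e₂∈ (∸-cancelˡ-≡ (label≤1+t e₁) (label≤1+t e₂)
          (trans (sym (compl e₁ e₁∈)) (trans eq (compl e₂ e₂∈))))
    ; noPair  = λ (i , 1≤i , i≤m , image₁ , image₂) →
        noPair (i , 1≤i , i≤m
               , subst (InImage G f) (m∸[m∸n]≡n (i≤1+t i≤m)) (complementImage image₂)
               , complementImage image₁)
    }
    where
    label≤1+t : ∀ e → edgeLabel f e ≤ suc t
    label≤1+t e = m≤n⇒m≤1+n (edgeLabel≤t e)
    i≤1+t : ∀ {i} → i ≤ length (edges G) → i ≤ suc t
    i≤1+t i≤m = m≤n⇒m≤1+n (≤-trans i≤m (≤-trans (m≤m+n _ _) tBig))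
    complementImage : ∀ {d} → InImage G g d → InImage G f (suc t ∸ d)
    complementImage {d} (e , e∈ , ge≡d) = e , e∈ , (begin
      edgeLabel f e                    ≡⟨ m∸[m∸n]≡n (label≤1+t e) ⟨
      suc t ∸ (suc t ∸ edgeLabel f e)  ≡⟨ cong (suc t ∸_) (trans (sym (compl e e∈)) ge≡d) ⟩
      suc t ∸ d                        ∎)
      where open ≡-Reasoning

module Shift {p q} (G : BipGraph p q) {t : ℕ} {f : Vtx p q → ℕ} (ρ : IsRhoBar G t f)
             {k : ℕ} (k≤t : k ≤ t) where
  open IsRhoBar ρ using (inj; bounded)

  fₖ : Vtx p q → ℕ
  fₖ = shift t f k

  fₖ-injective : Injective _≡_ _≡_ fₖ
  fₖ-injective {u} {v} = inj ∘ +-%-injective (s≤s (bounded u)) (s≤s (bounded v)) (m≤n⇒m≤1+n k≤t)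

  fₖ≤t : ∀ v → fₖ v ≤ t
  fₖ≤t v = s≤s⁻¹ (m%n<n (f v + k) (suc t))

  -- Both regimes are stated as  fₖ v + c ≡ f v + k,  with c = 0 for a label that stays and
  -- c = t + 1 for one that wraps around: the form the translate lemmas consume.
  fₖ-stays : ∀ v → f v + k ≤ t → fₖ v + 0 ≡ f v + k
  fₖ-stays v f+k≤t = trans (+-identityʳ (fₖ v)) (m≤n⇒m%n≡m f+k≤t)

  fₖ-wraps : ∀ v → t < f v + k → fₖ v + suc t ≡ f v + k
  fₖ-wraps v = [m+k]%[1+t]+[1+t]≡m+k (bounded v) k≤t

  k≤fₖ-stays : ∀ v → f v + k ≤ t → k ≤ fₖ v
  k≤fₖ-stays v f+k≤t = translate-≤ (+-identityʳ k) (fₖ-stays v f+k≤t) z≤n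

  fₖ<k-wraps : ∀ v → t < f v + k → fₖ v < k
  fₖ<k-wraps v t<f+k = translate-< (fₖ-wraps v t<f+k) (+-comm k (suc t)) (s≤s (bounded v))

  translation⇒uniformAB : ∀ c → (∀ v → fₖ v + c ≡ f v + k) →
                          ∀ x₀ → (∀ x → f (inj₁ x) ≤ f (inj₁ x₀)) →
                          (∀ y → f (inj₁ x₀) < f (inj₂ y)) → UniformAB G t fₖ
  translation⇒uniformAB c translation x₀ A≤x₀ x₀<B =
      isRhoBar-sameLabels ρ fₖ-injective fₖ≤t
        (λ e _ → translate-edgeLabel {f = f} {g = fₖ} translation e)
    , fₖ (inj₁ x₀)
    , (λ x → translate-≤ (translation (inj₁ x)) (translation (inj₁ x₀)) (A≤x₀ x))
    , (λ y → translate-< (translation (inj₁ x₀)) (translation (inj₂ y)) (x₀<B y))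

  module Criteria {α β γ : ℕ} {xα xβ : Fin p} {yγ yt : Fin q}
    (fxα≡α : f (inj₁ xα) ≡ α) (fxβ≡β : f (inj₁ xβ) ≡ β)
    (fyγ≡γ : f (inj₂ yγ) ≡ γ) (fyt≡t : f (inj₂ yt) ≡ t)
    (A-range : ∀ x → α ≤ f (inj₁ x) × f (inj₁ x) ≤ β) (γ≤B : ∀ y → γ ≤ f (inj₂ y))
    (β<γ : β < γ) where

    A<B : ∀ x y → f (inj₁ x) < f (inj₂ y)
    A<B x y = ≤-<-trans (proj₂ (A-range x)) (<-≤-trans β<γ (γ≤B y))

    A≤xβ : ∀ x → f (inj₁ x) ≤ f (inj₁ xβ)
    A≤xβ x = subst (f (inj₁ x) ≤_) (sym fxβ≡β) (proj₂ (A-range x))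

    α≤f : ∀ v → α ≤ f v
    α≤f (inj₁ x) = proj₁ (A-range x)
    α≤f (inj₂ y) = ≤-trans (proj₁ (A-range xβ)) (<⇒≤ (A<B xβ y))

    uniformAB-if : k ≡ 0 ⊎ t < α + k → UniformAB G t fₖ
    uniformAB-if (inj₁ k≡0) = translation⇒uniformAB 0 stays xβ A≤xβ (A<B xβ)
      where
      stays : ∀ v → fₖ v + 0 ≡ f v + k
      stays v = fₖ-stays v (subst (λ k → f v + k ≤ t) (sym k≡0)
                                  (subst (_≤ t) (sym (+-identityʳ (f v))) (bounded v)))
    uniformAB-if (inj₂ t<α+k) = translation⇒uniformAB (suc t) wraps xβ A≤xβ (A<B xβ)
      where
      wraps : ∀ v → fₖ v + suc t ≡ f v + k
      wraps v = fₖ-wraps v (<-≤-trans t<α+k (+-monoˡ-≤ k (α≤f v)))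

    uniformAB-onlyIf : UniformAB G t fₖ → k ≡ 0 ⊎ t < α + k
    uniformAB-onlyIf (_ , l , A≤l , l<B) with k ≟ 0 | α + k ≤? t
    ... | yes k≡0 | _         = inj₁ k≡0
    ... | no _    | no α+k≰t  = inj₂ (≰⇒> α+k≰t)
    ... | no k≢0  | yes α+k≤t = contradiction k≤fₖxα (<⇒≱ fₖxα<k)
      where
      yt-wraps : t < f (inj₂ yt) + k
      yt-wraps = subst (λ z → t < z + k) (sym fyt≡t) (m<m+n t (n≢0⇒n>0 k≢0))
      fₖxα<k : fₖ (inj₁ xα) < k
      fₖxα<k = ≤-<-trans (A≤l xα) (<-trans (l<B yt) (fₖ<k-wraps (inj₂ yt) yt-wraps))
      k≤fₖxα : k ≤ fₖ (inj₁ xα)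
      k≤fₖxα = k≤fₖ-stays (inj₁ xα) (subst (λ z → z + k ≤ t) (sym fxα≡α) α+k≤t)

    uniformBA-if : t < γ + k × β + k ≤ t → UniformBA G t fₖ
    uniformBA-if (t<γ+k , β+k≤t) =
        isRhoBar-complementLabels ρ fₖ-injective fₖ≤t complemented
      , fₖ (inj₂ yt)
      , (λ y → translate-≤ (fₖ-wraps (inj₂ y) (B-wraps y)) (fₖ-wraps (inj₂ yt) (B-wraps yt))
                           (subst (f (inj₂ y) ≤_) (sym fyt≡t) (bounded (inj₂ y))))
      , (λ x → <-≤-trans (fₖ<k-wraps (inj₂ yt) (B-wraps yt)) (k≤fₖ-stays (inj₁ x) (A-stays x)))
      where
      A-stays : ∀ x → f (inj₁ x) + k ≤ t
      A-stays x = ≤-trans (+-monoˡ-≤ k (proj₂ (A-range x))) β+k≤t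
      B-wraps : ∀ y → t < f (inj₂ y) + k
      B-wraps y = <-≤-trans t<γ+k (+-monoˡ-≤ k (γ≤B y))
      complemented : ∀ e → e ∈ edges G → edgeLabel fₖ e ≡ suc t ∸ edgeLabel f e
      complemented (x , y) _ =
        complement-dist (fₖ-stays (inj₁ x) (A-stays x)) (fₖ-wraps (inj₂ y) (B-wraps y))
          (<⇒≤ (A<B x y)) (≤-trans (m≤n⇒m≤1+n (bounded (inj₂ y))) (m≤n+m (suc t) (f (inj₁ x))))

    uniformBA-onlyIf : UniformBA G t fₖ → t < γ + k × β + k ≤ t
    uniformBA-onlyIf (_ , l , B≤l , l<A) = B-wraps , A-stays
      where
      below-xβ : ∀ y → fₖ (inj₂ y) < fₖ (inj₁ xβ)
      below-xβ y = ≤-<-trans (B≤l y) (l<A xβ)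
      B-wraps : t < γ + k
      B-wraps with γ + k ≤? t
      ... | no γ+k≰t = ≰⇒> γ+k≰t
      ... | yes γ+k≤t = contradiction (below-xβ yγ)
            (<⇒≯ (translate-< (fₖ-stays (inj₁ xβ) xβ-stays) (fₖ-stays (inj₂ yγ) yγ-stays)
                              (A<B xβ yγ)))
        where
        yγ-stays : f (inj₂ yγ) + k ≤ t
        yγ-stays = subst (λ z → z + k ≤ t) (sym fyγ≡γ) γ+k≤t
        xβ-stays : f (inj₁ xβ) + k ≤ t
        xβ-stays = ≤-trans (+-monoˡ-≤ k (<⇒≤ (A<B xβ yγ))) yγ-stays
      A-stays : β + k ≤ t
      A-stays with β + k ≤? t
      ... | yes β+k≤t = β+k≤t
      ... | no β+k≰t = contradiction (below-xβ yt)
            (<⇒≯ (translate-< (fₖ-wraps (inj₁ xβ) xβ-wraps) (fₖ-wraps (inj₂ yt) yt-wraps)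
                              (A<B xβ yt)))
        where
        xβ-wraps : t < f (inj₁ xβ) + k
        xβ-wraps = subst (λ z → t < z + k) (sym fxβ≡β) (≰⇒> β+k≰t)
        yt-wraps : t < f (inj₂ yt) + k
        yt-wraps = <-≤-trans xβ-wraps (+-monoˡ-≤ k (<⇒≤ (A<B xβ yt)))

    uniformAB⇔ : UniformAB G t fₖ ⇔ (k ≡ 0 ⊎ t < α + k)
    uniformAB⇔ = mk⇔ uniformAB-onlyIf uniformAB-if

    uniformBA⇔ : UniformBA G t fₖ ⇔ (t < γ + k × β + k ≤ t)
    uniformBA⇔ = mk⇔ uniformBA-onlyIf uniformBA-if

module Sequence {t s : ℕ} {a : ℕ → ℕ}
  (a-range : ∀ i → 1 ≤ i → i ≤ 2 * s → 1 ≤ a i × a i ≤ t)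
  (a-mono : ∀ i → 1 ≤ i → i ≤ 2 * s ∸ 1 → a i < a (suc i)) where

  Odd Even : ℕ → ℕ
  Odd  = sumTo (λ j → a (suc (2 * j)))
  Even = sumTo (λ j → a (2 * suc j))

  2[2+m]≤2s : ∀ {m} → suc (suc m) ≤ s → suc (suc (2 * suc m)) ≤ 2 * s
  2[2+m]≤2s {m} h = subst (_≤ 2 * s) (*-suc 2 (suc m)) (*-monoʳ-≤ 2 h)

  a-step : ∀ i → 1 ≤ i → suc i ≤ 2 * s → a i < a (suc i)
  a-step i 1≤i i<2s = a-mono i 1≤i (∸-monoˡ-≤ 1 i<2s)

  even<odd : ∀ m → suc (suc m) ≤ s → a (2 * suc m) < a (suc (2 * suc m))
  even<odd m h = a-step (2 * suc m) (s≤s z≤n) (<⇒≤ (2[2+m]≤2s h))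

  odd<even : ∀ m → suc (suc m) ≤ s → a (suc (2 * suc m)) < a (2 * suc (suc m))
  odd<even m h = subst (λ i → a (suc (2 * suc m)) < a i) (sym (*-suc 2 (suc m)))
                       (a-step (suc (2 * suc m)) (s≤s z≤n) (2[2+m]≤2s h))

  even<1+t : ∀ m → suc m ≤ s → a (2 * suc m) < suc t
  even<1+t m h = s≤s (proj₂ (a-range (2 * suc m) (s≤s z≤n) (*-monoʳ-≤ 2 h)))

  Even+a₁≤Odd : ∀ n → suc n ≤ s → Even n + a 1 ≤ Odd (suc n)
  Even+a₁≤Odd zero    _ = ≤-refl
  Even+a₁≤Odd (suc n) h = begin
    Even n + a (2 * suc n) + a 1      ≡⟨ xy∙z≈xz∙y (Even n) _ (a 1) ⟩
    Even n + a 1 + a (2 * suc n)      ≤⟨ +-monoˡ-≤ _ (Even+a₁≤Odd n (<⇒≤ h)) ⟩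
    Odd (suc n) + a (2 * suc n)       ≤⟨ +-monoʳ-≤ (Odd (suc n)) (<⇒≤ (even<odd n h)) ⟩
    Odd (suc n) + a (suc (2 * suc n)) ∎
    where open ≤-Reasoning

  Even≤Odd : ∀ n → suc n ≤ s → Even n ≤ Odd (suc n)
  Even≤Odd n h = ≤-trans (m≤m+n (Even n) (a 1)) (Even+a₁≤Odd n h)

  xs+Even : ∀ n → suc n ≤ s → xs a (suc n) + Even n ≡ Odd (suc n)
  xs+Even n h = m∸n+n≡m (Even≤Odd n h)

  ys+Even : ∀ n → suc n ≤ s → ys a (suc t) (suc n) + Even (suc n) ≡ Odd (suc n) + suc t
  ys+Even n h = m∸n+n≡m (+-mono-≤ (Even≤Odd n h) (<⇒≤ (even<1+t n h)))

  a₁≤xs : ∀ n → suc n ≤ s → a 1 ≤ xs a (suc n)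
  a₁≤xs n h = +-cancelʳ-≤ (Even n) (a 1) (xs a (suc n)) (begin
    a 1 + Even n            ≡⟨ +-comm (a 1) (Even n) ⟩
    Even n + a 1            ≤⟨ Even+a₁≤Odd n h ⟩
    Odd (suc n)             ≡⟨ xs+Even n h ⟨
    xs a (suc n) + Even n   ∎)
    where open ≤-Reasoning

  xs<xs : ∀ n → suc (suc n) ≤ s → xs a (suc n) < xs a (suc (suc n))
  xs<xs n h = +-balance-< (+-cancelʳ-≡ (Even n) _ _ (begin
    xs a (suc (suc n)) + b + Even n  ≡⟨ xy∙z≈x∙zy (xs a (suc (suc n))) b (Even n) ⟩
    xs a (suc (suc n)) + Even (suc n) ≡⟨ xs+Even (suc n) h ⟩
    Odd (suc n) + c                  ≡⟨ cong (_+ c) (xs+Even n (<⇒≤ h)) ⟨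
    xs a (suc n) + Even n + c        ≡⟨ xy∙z≈xz∙y (xs a (suc n)) (Even n) c ⟩
    xs a (suc n) + c + Even n        ∎)) (even<odd n h)
    where
    open ≡-Reasoning
    b = a (2 * suc n)
    c = a (suc (2 * suc n))

  ys<ys : ∀ n → suc (suc n) ≤ s → ys a (suc t) (suc (suc n)) < ys a (suc t) (suc n)
  ys<ys n h = +-balance-< (+-cancelʳ-≡ (Even (suc n)) _ _ (begin
    y₁ + b + Even (suc n)              ≡⟨ xy∙z≈xz∙y y₁ b (Even (suc n)) ⟩
    y₁ + Even (suc n) + b              ≡⟨ cong (_+ b) (ys+Even n (<⇒≤ h)) ⟩
    Odd (suc n) + suc t + b            ≡⟨ xy∙z≈xz∙y (Odd (suc n)) (suc t) b ⟩
    Odd (suc (suc n)) + suc t          ≡⟨ ys+Even (suc n) h ⟨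
    y₂ + (Even (suc n) + c)            ≡⟨ x∙yz≈xz∙y y₂ (Even (suc n)) c ⟩
    y₂ + c + Even (suc n)              ∎)) (odd<even n h)
    where
    open ≡-Reasoning
    y₁ = ys a (suc t) (suc n)
    y₂ = ys a (suc t) (suc (suc n))
    b = a (suc (2 * suc n))
    c = a (2 * suc (suc n))

  xs<ys : ∀ n → suc n ≤ s → xs a (suc n) < ys a (suc t) (suc n)
  xs<ys n h = +-balance-< (+-cancelʳ-≡ (Even n) _ _ (begin
    y + b + Even n           ≡⟨ xy∙z≈x∙zy y b (Even n) ⟩
    y + Even (suc n)         ≡⟨ ys+Even n h ⟩
    Odd (suc n) + suc t      ≡⟨ cong (_+ suc t) (xs+Even n h) ⟨
    x + Even n + suc t       ≡⟨ xy∙z≈xz∙y x (Even n) (suc t) ⟩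
    x + suc t + Even n       ∎)) (even<1+t n h)
    where
    open ≡-Reasoning
    x = xs a (suc n)
    y = ys a (suc t) (suc n)
    b = a (2 * suc n)

  xs-range : ∀ i → 1 ≤ i → i ≤ s → a 1 ≤ xs a i × xs a i ≤ xs a s
  xs-range (suc n) 1≤i i≤s =
      a₁≤xs n i≤s
    , stepwise (λ i j → xs a i ≤ xs a j) ≤-refl ≤-trans step 1≤i i≤s ≤-refl
    where
    step : ∀ i → 1 ≤ i → suc i ≤ s → xs a i ≤ xs a (suc i)
    step (suc m) _ h = <⇒≤ (xs<xs m h)

  ys-range : ∀ i → 1 ≤ i → i ≤ s → ys a (suc t) s ≤ ys a (suc t) i
  ys-range i 1≤i i≤s =
    stepwise (λ i j → ys a (suc t) j ≤ ys a (suc t) i) ≤-refl (λ p q → ≤-trans q p) step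
             1≤i i≤s ≤-refl
    where
    step : ∀ i → 1 ≤ i → suc i ≤ s → ys a (suc t) (suc i) ≤ ys a (suc t) i
    step (suc m) _ h = <⇒≤ (ys<ys m h)

wraps⇔ : ∀ {t m k} → 1 ≤ m → t < (m ∸ 1) + k ⇔ suc t + 1 ∸ m ≤ k
wraps⇔ {t} {suc m} {k} _ = mk⇔
  (λ t<m+k → m≤n+o⇒m∸n≤o (t + 1) m (subst (_≤ m + k) (+-comm 1 t) t<m+k))
  (λ t+1∸m≤k → subst (_≤ m + k) (+-comm t 1)
                  (≤-trans (m≤n+m∸n (t + 1) m) (+-monoʳ-≤ m t+1∸m≤k)))

stays⇔ : ∀ {t m k} → 1 ≤ m → m ∸ 1 ≤ t → (m ∸ 1) + k ≤ t ⇔ k ≤ suc t ∸ m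
stays⇔ {t} {suc m} {k} _ m≤t = mk⇔
  (λ m+k≤t → m+n≤o⇒m≤o∸n k (subst (_≤ t) (+-comm m k) m+k≤t))
  (λ k≤t∸m → subst (_≤ t) (+-comm k m) (m≤o∸n⇒m+n≤o k m≤t k≤t∸m))

corollary2 : (r s : ℕ) → 2 * s + 1 ≤ r →
    (a : ℕ → ℕ) →
    (∀ i → 1 ≤ i → i ≤ 2 * s → 1 ≤ a i × a i ≤ r ∸ 1) →
    (∀ i → 1 ≤ i → i ≤ 2 * s ∸ 1 → a i < a (suc i)) →
    (G : BipGraph s (suc s)) → (f : Vtx s (suc s) → ℕ) →
    IsRhoBar G (r ∸ 1) f →
    (∀ x → ∃ λ i → 1 ≤ i × i ≤ s × f (inj₁ x) ≡ xs a i ∸ 1) →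
    (∀ i → 1 ≤ i → i ≤ s → ∃ λ x → f (inj₁ x) ≡ xs a i ∸ 1) →
    (∀ y → (∃ λ i → 1 ≤ i × i ≤ s × f (inj₂ y) ≡ ys a r i ∸ 1) ⊎ f (inj₂ y) ≡ r ∸ 1) →
    (∀ i → 1 ≤ i → i ≤ s → ∃ λ y → f (inj₂ y) ≡ ys a r i ∸ 1) →
    (∃ λ y → f (inj₂ y) ≡ r ∸ 1) →
    (k : ℕ) → k ≤ r ∸ 1 →
    ((2 ≤ a 1 → (UniformAB G (r ∸ 1) (shift (r ∸ 1) f k) ⇔
                   (k ≡ 0 ⊎ (r + 1 ∸ a 1 ≤ k × k ≤ r ∸ 1))))
     × (a 1 ≡ 1 → (UniformAB G (r ∸ 1) (shift (r ∸ 1) f k) ⇔ k ≡ 0)))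
    × (UniformBA G (r ∸ 1) (shift (r ∸ 1) f k) ⇔
         (r + 1 ∸ ys a r s ≤ k × k ≤ r ∸ xs a s))
corollary2 _ zero _ _ _ _ G _ _ _ _ _ _ _ _ _ = ⊥-elim (¬Fin0 (proj₁ (noIsolB G Fin.zero)))
corollary2 zero (suc _) ()
corollary2 (suc t) (suc n) _ a a-range a-mono G f ρ fA fA-onto fB fB-onto (_ , fyt≡t) k k≤t =
    ( (λ _ → (⇔-id (k ≡ 0) ⊎-⇔ wraps-in-range) ⇔-∘ uniformAB⇔)
    , (λ a₁≡1 → never-wraps a₁≡1 ⇔-∘ uniformAB⇔) )
  , (wraps⇔ 1≤Y ×-⇔ stays⇔ 1≤X β≤t) ⇔-∘ uniformBA⇔
  where
  open IsRhoBar ρ using (bounded)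
  open Sequence {t} {suc n} a-range a-mono
  X = xs a (suc n)
  Y = ys a (suc t) (suc n)
  1≤s : 1 ≤ suc n
  1≤s = s≤s z≤n
  1≤a₁ : 1 ≤ a 1
  1≤a₁ = proj₁ (a-range 1 ≤-refl (s≤s z≤n))
  1≤X : 1 ≤ X
  1≤X = ≤-trans 1≤a₁ (proj₁ (xs-range (suc n) 1≤s ≤-refl))
  1≤Y : 1 ≤ Y
  1≤Y = ≤-trans 1≤X (<⇒≤ (xs<ys n ≤-refl))
  xβ = fA-onto (suc n) 1≤s ≤-refl
  yγ = fB-onto (suc n) 1≤s ≤-refl
  β≤t : X ∸ 1 ≤ t
  β≤t = subst (_≤ t) (proj₂ xβ) (bounded (inj₁ (proj₁ xβ)))
  A-range : ∀ x → a 1 ∸ 1 ≤ f (inj₁ x) × f (inj₁ x) ≤ X ∸ 1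
  A-range x with fA x
  ... | i , 1≤i , i≤s , fx≡ rewrite fx≡ = map (∸-monoˡ-≤ 1) (∸-monoˡ-≤ 1) (xs-range i 1≤i i≤s)
  γ≤B : ∀ y → Y ∸ 1 ≤ f (inj₂ y)
  γ≤B y with fB y
  ... | inj₁ (i , 1≤i , i≤s , fy≡) rewrite fy≡ = ∸-monoˡ-≤ 1 (ys-range i 1≤i i≤s)
  ... | inj₂ fy≡t rewrite fy≡t = subst (_≤ t) (proj₂ yγ) (bounded (inj₂ (proj₁ yγ)))
  open Shift G ρ k≤t
  open Criteria (proj₂ (fA-onto 1 ≤-refl 1≤s)) (proj₂ xβ) (proj₂ yγ) fyt≡t A-range γ≤B
                (∸-monoˡ-< (xs<ys n ≤-refl) 1≤X)
  wraps-in-range : t < (a 1 ∸ 1) + k ⇔ (suc t + 1 ∸ a 1 ≤ k × k ≤ t)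
  wraps-in-range = mk⇔ (λ wraps → Equivalence.to (wraps⇔ 1≤a₁) wraps , k≤t)
                       (Equivalence.from (wraps⇔ 1≤a₁) ∘ proj₁)
  never-wraps : a 1 ≡ 1 → (k ≡ 0 ⊎ t < (a 1 ∸ 1) + k) ⇔ k ≡ 0
  never-wraps a₁≡1 = mk⇔ [ id , (λ wraps → contradiction (subst (λ m → t < (m ∸ 1) + k) a₁≡1 wraps)
                                                        (≤⇒≯ k≤t)) ] inj₁
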